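{- Let $F_1,\ldots,F_k$ be vertex-disjoint paths where, for each $i\in[k]$, $F_i = P'_{n_i}$ or $F_i = P''_{n_i}$ with $n_i\ge 1$. Then \[ \gamma_g^\prime\Big(\bigcup_{i=1}^k F_i\Big) \le \Big\lceil \sum_{i=1}^k {\rm w}(F_i)\Big\rceil . \]
   Context: Domination game: on a graph, Dominator and Staller alternately choose vertices; a chosen vertex must dominate (its closed neighborhood must contain) at least one vertex not yet dominated. The game ends when no legal move exists; Dominator minimizes and Staller maximizes the number of moves. For a partially dominated graph (a graph with some vertices declared already dominated), $\gamma_g^\prime$ denotes the number of moves under optimal play when Staller moves first. $P'_n$ is the path $P_{n+1}$ on $n+1$ vertices with one end-vertex declared dominated; $P''_n$ is the path $P_{n+2}$ with both end-vertices declared dominated. The weight is defined, for $q\ge 0$ and $r\in\{0,1,2,3\}$, by ${\rm w}(P'_{4q+r})={\rm w}(P''_{4q+r}) = 2q + c_r$ where $c_0=0$, $c_1=1$, $c_2=3/2$, $c_3=7/4$. -}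

module Defs where

open import Data.Bool using (Bool; true; false; _∧_; _∨_; not; if_then_else_)
open import Data.Nat using (ℕ; zero; suc; _+_; _∸_; _≡ᵇ_; _<ᵇ_; _⊔_; _⊓_; _/_; _%_)
open import Data.List using (List; []; _∷_; filter; map; upTo; foldr)
open import Data.Bool.ListAction using (any)
open import Data.Product using (_×_; _,_)
open import Relation.Nullary.Decidable using (does)
open import Data.Bool.Properties using (_≟_)
open import Data.Integer using (ℤ; +_)
open import Data.Rational using (ℚ; 0ℚ; 1ℚ) renaming (_+_ to _+ℚ_; _/_ to _÷_)

-- Partially dominated finite graphs.
-- Vertices are the naturals 0 … size-1; adj is the (symmetric) adjacency
-- relation; predom marks the vertices declared already dominated.

record PDGraph : Set where
  field
    size   : ℕ
    adj    : ℕ → ℕ → Bool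
    predom : ℕ → Bool
open PDGraph public

inN : PDGraph → ℕ → ℕ → Bool
inN G v u = (u ≡ᵇ v) ∨ adj G v u

legal : PDGraph → (ℕ → Bool) → ℕ → Bool
legal G D v = any (λ u → inN G v u ∧ not (D u)) (upTo (size G))

play : PDGraph → (ℕ → Bool) → ℕ → (ℕ → Bool)
play G D v u = D u ∨ inN G v u

maxL minL : List ℕ → ℕ
maxL []       = 0
maxL (x ∷ xs) = foldr _⊔_ x xs
minL []       = 0
minL (x ∷ xs) = foldr _⊓_ x xs

-- Number of remaining moves under optimal play (Dominator minimises,
-- Staller maximises).  The Bool is true when Staller is to move.
-- The first argument is fuel; since every move dominates a new vertex,
-- fuel = size G always suffices (the game has at most size G moves).
value : PDGraph → ℕ → Bool → (ℕ → Bool) → ℕ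
value G zero    s D = 0
value G (suc f) s D with filter (λ v → legal G D v ≟ true) (upTo (size G))
... | []    = 0
... | moves = suc ((if s then maxL else minL)
                     (map (λ v → value G f (not s) (play G D v)) moves))

gammaG' : PDGraph → ℕ
gammaG' G = value G (size G) true (predom G)

pathAdj : ℕ → ℕ → Bool
pathAdj u v = (suc u ≡ᵇ v) ∨ (suc v ≡ᵇ u)

_⊎G_ : PDGraph → PDGraph → PDGraph
G ⊎G H = record
  { size   = size G + size H
  ; adj    = λ u v → if u <ᵇ size G
                       then (v <ᵇ size G) ∧ adj G u v
                       else not (v <ᵇ size G) ∧ adj H (u ∸ size G) (v ∸ size G)
  ; predom = λ u → if u <ᵇ size G then predom G u else predom H (u ∸ size G)
  }

emptyG : PDGraph
emptyG = record { size = 0 ; adj = λ _ _ → false ; predom = λ _ → false }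

data Kind : Set where
  single : Kind   -- P'_n  : path P_{n+1}, one end-vertex predominated
  double : Kind   -- P''_n : path P_{n+2}, both end-vertices predominated

pathG : Kind × ℕ → PDGraph
pathG (single , n) = record
  { size = suc n ; adj = pathAdj ; predom = λ u → u ≡ᵇ 0 }
pathG (double , n) = record
  { size = suc (suc n) ; adj = pathAdj
  ; predom = λ u → (u ≡ᵇ 0) ∨ (u ≡ᵇ suc n) }

unionG : List (Kind × ℕ) → PDGraph
unionG []       = emptyG
unionG (F ∷ Fs) = pathG F ⊎G unionG Fs

cr : ℕ → ℚ
cr 0 = 0ℚ
cr 1 = 1ℚ
cr 2 = + 3 ÷ 2
cr _ = + 7 ÷ 4

weight : Kind × ℕ → ℚ
weight (_ , n) = (+ (2 Data.Nat.* (n / 4)) ÷ 1) +ℚ cr (n % 4)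

totalWeight : List (Kind × ℕ) → ℚ
totalWeight []       = 0ℚ
totalWeight (F ∷ Fs) = weight F +ℚ totalWeight Fs

-- A position of the game on a disjoint union of partially dominated paths is
-- captured by the multiset of lengths of its maximal runs of undominated
-- vertices.  Let w4 be four times the weight, w4 (4q + r) = 8q + (0, 4, 6, 7)
-- for r = 0, 1, 2, 3, and C the ceiling of the total weight, so that the runs initially weigh at most
-- 4·C.  Whatever Staller plays, Dominator can reply so that the two moves
-- together lower the weight by at least 8: a suitable reply inside the run
-- Staller touched usually suffices, and when Staller leaves no slack the
-- missing amount comes from the weight of the untouched runs being divisible
-- by 4 (or by 2), as 4·C is.  Since Staller can only
-- move while some run, hence weight at least 4, is left, a Staller-start game
-- lasts at most C moves.

module Submission where

open import Data.Bool using (Bool; true; false; T; not; _∧_; _∨_)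
open import Data.Bool.Properties using (∨-zeroʳ; ∨-identityʳ; T-≡; T-not-≡; T-∧; _≟_)
open import Data.Empty using (⊥; ⊥-elim)
import Data.Integer as ℤ
import Data.Integer.Properties as ℤ
open import Data.Integer.DivMod using ([n/d]*d≤n)
open import Data.Integer.Tactic.RingSolver using (solve-∀)
open import Data.List using (List; []; _∷_; _++_; replicate; length; upTo; map; filter; foldr)
open import Data.List.Membership.Propositional using (_∈_; find; lose)
open import Data.List.Membership.Propositional.Properties
  using (∈-++⁺ˡ; ∈-++⁺ʳ; ∈-++⁻; ∈-filter⁺; ∈-filter⁻; ∈-upTo⁺; ∈-upTo⁻; ∈-map⁺)
open import Data.List.Properties using (++-assoc; ++-identityʳ)
open import Data.List.Relation.Unary.Any using (here; there)
open import Data.List.Relation.Unary.Any.Properties using (any⁺; any⁻)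
open import Data.List.Relation.Unary.All as All using (All; []; _∷_; tabulate)
import Data.List.Relation.Unary.All.Properties as All
open import Data.Nat hiding (_≟_)
open import Data.Nat.Divisibility using (_∣_; divides; ∣m∣n⇒∣m+n; ∣m+n∣m⇒∣n; ∣⇒≤; ∣m⇒∣m*n)
open import Data.Nat.DivMod using (m≡m%n+[m/n]*n; m%n<n)
open import Data.Nat.Properties hiding (_≟_)
open import Algebra.Properties.CommutativeSemigroup +-commutativeSemigroup using (xy∙z≈xz∙y; x∙yz≈y∙xz; x∙yz≈xz∙y)
open import Data.Product using (∃; _×_; _,_; proj₁; proj₂)
open import Data.Rational as ℚ using (mkℚ; toℚᵘ; floor; ceiling; ↥_; ↧_)
import Data.Rational.Properties as ℚ
open import Data.Rational.Unnormalised as ℚᵘ using (mkℚᵘ; _≃_; *≡*)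
import Data.Rational.Unnormalised.Properties as ℚᵘ
open import Data.Sum using (_⊎_; inj₁; inj₂)
open import Function.Base using (_∘_)
open import Function.Bundles using (Equivalence)
open import Relation.Binary.PropositionalEquality
open import Relation.Nullary using (yes; no; contradiction)
open import Defs

-- Runs of undominated vertices

infixr 5 _∷⁺_

_∷⁺_ : ℕ → List ℕ → List ℕ
zero  ∷⁺ ns = ns
suc k ∷⁺ ns = suc k ∷ ns

∷⁺-++ : ∀ k ns → k ∷⁺ ns ≡ (k ∷⁺ []) ++ ns
∷⁺-++ zero    ns = refl
∷⁺-++ (suc k) ns = refl

∷⁺∷⁺-++ : ∀ k l ns → k ∷⁺ l ∷⁺ ns ≡ (k ∷⁺ l ∷⁺ []) ++ ns
∷⁺∷⁺-++ zero    l ns = ∷⁺-++ l ns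
∷⁺∷⁺-++ (suc k) l ns = cong (suc k ∷_) (∷⁺-++ l ns)

∈-∷⁺⁻ : ∀ {m} k ns → m ∈ k ∷⁺ ns → (m ≡ k × 1 ≤ k) ⊎ m ∈ ns
∈-∷⁺⁻ zero    ns p           = inj₂ p
∈-∷⁺⁻ (suc k) ns (here refl) = inj₁ (refl , s≤s z≤n)
∈-∷⁺⁻ (suc k) ns (there p)   = inj₂ p

-- A list of Booleans records which vertices of a path are dominated
-- (true = dominated); runs k ts lists the lengths of its maximal blocks of
-- undominated vertices, k of which are already counted for the first block.
runs : ℕ → List Bool → List ℕ
runs k []           = k ∷⁺ []
runs k (false ∷ ts) = runs (suc k) ts
runs k (true  ∷ ts) = k ∷⁺ runs 0 ts

runs-leading : ∀ ts → ∃ λ r → ∃ λ ns → ∀ k → runs k ts ≡ (k + r) ∷⁺ ns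
runs-leading [] = 0 , [] , λ k → cong (_∷⁺ []) (sym (+-identityʳ k))
runs-leading (true ∷ ts) = 0 , runs 0 ts , λ k → cong (_∷⁺ runs 0 ts) (sym (+-identityʳ k))
runs-leading (false ∷ ts) with runs-leading ts
... | r , ns , eq = suc r , ns , λ k → trans (eq (suc k)) (cong (_∷⁺ ns) (sym (+-suc k r)))

runs-replicate : ∀ k j ts → runs k (replicate j false ++ ts) ≡ runs (j + k) ts
runs-replicate k zero    ts = refl
runs-replicate k (suc j) ts = trans (runs-replicate (suc k) j ts) (cong (λ x → runs x ts) (+-suc j k))

runs-++-true : ∀ k ts us → runs k (ts ++ true ∷ us) ≡ runs k ts ++ runs 0 us
runs-++-true k []           us = ∷⁺-++ k _
runs-++-true k (false ∷ ts) us = runs-++-true (suc k) ts us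
runs-++-true k (true ∷ ts)  us = begin
  k ∷⁺ runs 0 (ts ++ true ∷ us)      ≡⟨ cong (k ∷⁺_) (runs-++-true 0 ts us) ⟩
  k ∷⁺ (runs 0 ts ++ runs 0 us)      ≡⟨ ∷⁺-++ k _ ⟩
  (k ∷⁺ []) ++ runs 0 ts ++ runs 0 us ≡⟨ ++-assoc (k ∷⁺ []) _ _ ⟨
  ((k ∷⁺ []) ++ runs 0 ts) ++ runs 0 us ≡⟨ cong (_++ runs 0 us) (∷⁺-++ k _) ⟨
  (k ∷⁺ runs 0 ts) ++ runs 0 us      ∎
  where open ≡-Reasoning

StartsDominated : List Bool → Set
StartsDominated ts = ts ≡ [] ⊎ ∃ λ us → ts ≡ true ∷ us

runs-StartsDominated : ∀ k ts → StartsDominated ts → runs k ts ≡ k ∷⁺ runs 0 ts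
runs-StartsDominated k .[]         (inj₁ refl)       = refl
runs-StartsDominated k .(true ∷ _) (inj₂ (_ , refl)) = refl

runs-block : ∀ n ts → StartsDominated ts → runs 0 (replicate n false ++ ts) ≡ n ∷⁺ runs 0 ts
runs-block n ts sd = begin
  runs 0 (replicate n false ++ ts) ≡⟨ runs-replicate 0 n ts ⟩
  runs (n + 0) ts                  ≡⟨ cong (λ k → runs k ts) (+-identityʳ n) ⟩
  runs n ts                        ≡⟨ runs-StartsDominated n ts sd ⟩
  n ∷⁺ runs 0 ts                   ∎
  where open ≡-Reasoning

markHead : List Bool → List Bool
markHead []       = []
markHead (_ ∷ ts) = true ∷ ts

dominateAt : List Bool → ℕ → List Bool
dominateAt []       _             = []
dominateAt (_ ∷ ts) zero          = true ∷ markHead ts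
dominateAt (_ ∷ ts) (suc zero)    = true ∷ dominateAt ts zero
dominateAt (t ∷ ts) (suc (suc v)) = t ∷ dominateAt ts (suc v)

Undominated : List Bool → ℕ → Set
Undominated []           _       = ⊥
Undominated (t ∷ _)      zero    = t ≡ false
Undominated (_ ∷ ts)     (suc j) = Undominated ts j

_∈N[_] : ℕ → ℕ → Set
j ∈N[ v ] = j ≡ v ⊎ j ≡ suc v ⊎ suc j ≡ v

LegalAt : List Bool → ℕ → Set
LegalAt ts v = ∃ λ j → j ∈N[ v ] × Undominated ts j

LegalAt-tail : ∀ t ts v → LegalAt (t ∷ ts) (suc (suc v)) → LegalAt ts (suc v)
LegalAt-tail t ts v (suc j , inj₁ refl        , u) = j , inj₁ refl , u
LegalAt-tail t ts v (suc j , inj₂ (inj₁ refl) , u) = j , inj₂ (inj₁ refl) , u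
LegalAt-tail t ts v (suc j , inj₂ (inj₂ refl) , u) = j , inj₂ (inj₂ refl) , u

LegalAt-0 : ∀ ts → LegalAt ts 0 → Undominated ts 0 ⊎ Undominated ts 1
LegalAt-0 _ (.0 , inj₁ refl        , u) = inj₁ u
LegalAt-0 _ (.1 , inj₂ (inj₁ refl) , u) = inj₂ u

LegalAt-1 : ∀ ts → LegalAt ts 1 → Undominated ts 0 ⊎ Undominated ts 1 ⊎ Undominated ts 2
LegalAt-1 _ (.1 , inj₁ refl        , u) = inj₂ (inj₁ u)
LegalAt-1 _ (.2 , inj₂ (inj₁ refl) , u) = inj₂ (inj₂ u)
LegalAt-1 _ (.0 , inj₂ (inj₂ refl) , u) = inj₁ u

-- How one move can shorten a single run of length n: by one or two vertices
-- at an end, or by three consecutive vertices splitting it in two.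
data StallerCut : ℕ → List ℕ → Set where
  trim₁ : ∀ n → StallerCut (suc n) (n ∷⁺ [])
  trim₂ : ∀ n → StallerCut (suc n) (pred n ∷⁺ [])
  split : ∀ a b → StallerCut (3 + a + b) (a ∷⁺ b ∷⁺ [])

-- A move on a dominated vertex between two runs shortens both.
data StallerMove : List ℕ → List ℕ → Set where
  inRun  : ∀ P Q n ns → StallerCut n ns → StallerMove (P ++ n ∷ Q) (P ++ ns ++ Q)
  across : ∀ P Q m n → StallerMove (P ++ suc m ∷ suc n ∷ Q) (P ++ m ∷⁺ n ∷⁺ Q)

inRun-≡ : ∀ {L L′} P Q n ns → StallerCut n ns → L ≡ P ++ n ∷ Q → L′ ≡ P ++ ns ++ Q → StallerMove L L′
inRun-≡ P Q n ns c refl refl = inRun P Q n ns c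

across-≡ : ∀ {L L′} P Q m n → L ≡ P ++ suc m ∷ suc n ∷ Q → L′ ≡ P ++ m ∷⁺ n ∷⁺ Q → StallerMove L L′
across-≡ P Q m n refl refl = across P Q m n

StallerMove-source : ∀ {L L′} → StallerMove L L′ → ∃ (_∈ L)
StallerMove-source (inRun P Q n ns _) = n , ∈-++⁺ʳ P (here refl)
StallerMove-source (across P Q m n)   = suc m , ∈-++⁺ʳ P (here refl)

∷-StallerMove : ∀ x {L L′} → StallerMove L L′ → StallerMove (x ∷ L) (x ∷ L′)
∷-StallerMove x (inRun P Q n ns c) = inRun (x ∷ P) Q n ns c
∷-StallerMove x (across P Q m n)   = across (x ∷ P) Q m n

∷⁺-StallerMove : ∀ x {L L′} → StallerMove L L′ → StallerMove (x ∷⁺ L) (x ∷⁺ L′)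
∷⁺-StallerMove zero    s = s
∷⁺-StallerMove (suc x) s = ∷-StallerMove (suc x) s

dominateAt-0⇒StallerMove : ∀ ts → LegalAt ts 0 → StallerMove (runs 0 ts) (runs 0 (dominateAt ts 0))
dominateAt-0⇒StallerMove (false ∷ []) _ = inRun [] [] 1 [] (trim₁ 0)
dominateAt-0⇒StallerMove (true ∷ []) legal with LegalAt-0 (true ∷ []) legal
... | inj₁ ()
... | inj₂ ()
dominateAt-0⇒StallerMove (t ∷ u ∷ ts) legal = cut t u (LegalAt-0 (t ∷ u ∷ ts) legal)
  where
  r  = proj₁ (runs-leading ts)
  ns = proj₁ (proj₂ (runs-leading ts))
  eq = proj₂ (proj₂ (runs-leading ts))
  cut : ∀ t u → Undominated (t ∷ u ∷ ts) 0 ⊎ Undominated (t ∷ u ∷ ts) 1 →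
        StallerMove (runs 0 (t ∷ u ∷ ts)) (runs 0 (true ∷ true ∷ ts))
  cut false false _ = inRun-≡ [] ns (2 + r) (r ∷⁺ []) (trim₂ (suc r)) (eq 2) (trans (eq 0) (∷⁺-++ r ns))
  cut false true  _ = inRun [] (runs 0 ts) 1 [] (trim₁ 0)
  cut true  false _ = inRun-≡ [] ns (suc r) (r ∷⁺ []) (trim₁ r) (eq 1) (trans (eq 0) (∷⁺-++ r ns))
  cut true  true  (inj₁ ())
  cut true  true  (inj₂ ())

dominateAt-1⇒StallerMove : ∀ k ts → LegalAt ts 1 → StallerMove (runs k ts) (runs k (dominateAt ts 1))
dominateAt-1⇒StallerMove k (false ∷ []) _ =
  inRun-≡ [] [] (suc k) (k ∷⁺ []) (trim₁ k) refl (sym (++-identityʳ _))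
dominateAt-1⇒StallerMove k (true ∷ []) legal with LegalAt-1 (true ∷ []) legal
... | inj₁ ()
... | inj₂ (inj₁ ())
... | inj₂ (inj₂ ())
dominateAt-1⇒StallerMove k (false ∷ false ∷ []) _ =
  inRun-≡ [] [] (2 + k) (k ∷⁺ []) (trim₂ (suc k)) refl (sym (++-identityʳ _))
dominateAt-1⇒StallerMove k (false ∷ true ∷ []) _ =
  inRun-≡ [] [] (suc k) (k ∷⁺ []) (trim₁ k) refl (sym (++-identityʳ _))
dominateAt-1⇒StallerMove k (true ∷ false ∷ []) _ =
  inRun-≡ (k ∷⁺ []) [] 1 [] (trim₁ 0) (∷⁺-++ k _) (sym (++-identityʳ _))
dominateAt-1⇒StallerMove k (true ∷ true ∷ []) legal with LegalAt-1 (true ∷ true ∷ []) legal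
... | inj₁ ()
... | inj₂ (inj₁ ())
... | inj₂ (inj₂ ())
dominateAt-1⇒StallerMove k (t ∷ u ∷ w ∷ ts) legal = cut t u w (LegalAt-1 (t ∷ u ∷ w ∷ ts) legal)
  where
  r  = proj₁ (runs-leading ts)
  ns = proj₁ (proj₂ (runs-leading ts))
  eq = proj₂ (proj₂ (runs-leading ts))
  k∷⁺ : ∀ {X Y} → X ≡ Y → k ∷⁺ X ≡ (k ∷⁺ []) ++ Y
  k∷⁺ e = trans (cong (k ∷⁺_) e) (∷⁺-++ k _)
  cut : ∀ t u w →
        Undominated (t ∷ u ∷ w ∷ ts) 0 ⊎ Undominated (t ∷ u ∷ w ∷ ts) 1 ⊎ Undominated (t ∷ u ∷ w ∷ ts) 2 →
        StallerMove (runs k (t ∷ u ∷ w ∷ ts)) (runs k (true ∷ true ∷ true ∷ ts))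
  cut false false false _ = inRun-≡ [] ns (3 + k + r) (k ∷⁺ r ∷⁺ []) (split k r) (eq (3 + k))
                              (trans (cong (k ∷⁺_) (eq 0)) (∷⁺∷⁺-++ k r ns))
  cut false false true  _ = inRun-≡ [] (runs 0 ts) (2 + k) (k ∷⁺ []) (trim₂ (suc k)) refl (∷⁺-++ k _)
  cut false true  false _ = across-≡ [] ns k r (cong (suc k ∷_) (eq 1)) (cong (k ∷⁺_) (eq 0))
  cut false true  true  _ = inRun-≡ [] (runs 0 ts) (suc k) (k ∷⁺ []) (trim₁ k) refl (∷⁺-++ k _)
  cut true  false false _ = inRun-≡ (k ∷⁺ []) ns (2 + r) (r ∷⁺ []) (trim₂ (suc r)) (k∷⁺ (eq 2))
                              (k∷⁺ (trans (eq 0) (∷⁺-++ r ns)))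
  cut true  false true  _ = inRun-≡ (k ∷⁺ []) (runs 0 ts) 1 [] (trim₁ 0) (∷⁺-++ k _) (∷⁺-++ k _)
  cut true  true  false _ = inRun-≡ (k ∷⁺ []) ns (suc r) (r ∷⁺ []) (trim₁ r) (k∷⁺ (eq 1))
                              (k∷⁺ (trans (eq 0) (∷⁺-++ r ns)))
  cut true  true  true  (inj₁ ())
  cut true  true  true  (inj₂ (inj₁ ()))
  cut true  true  true  (inj₂ (inj₂ ()))

dominateAt-suc⇒StallerMove : ∀ k ts v → LegalAt ts (suc v) →
  StallerMove (runs k ts) (runs k (dominateAt ts (suc v)))
dominateAt-suc⇒StallerMove k ts zero legal = dominateAt-1⇒StallerMove k ts legal
dominateAt-suc⇒StallerMove k (false ∷ ts) (suc v) legal =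
  dominateAt-suc⇒StallerMove (suc k) ts v (LegalAt-tail false ts v legal)
dominateAt-suc⇒StallerMove k (true ∷ ts) (suc v) legal =
  ∷⁺-StallerMove k (dominateAt-suc⇒StallerMove 0 ts v (LegalAt-tail true ts v legal))

LegalAt⇒StallerMove : ∀ ts v → LegalAt ts v → StallerMove (runs 0 ts) (runs 0 (dominateAt ts v))
LegalAt⇒StallerMove ts zero    = dominateAt-0⇒StallerMove ts
LegalAt⇒StallerMove ts (suc v) = dominateAt-suc⇒StallerMove 0 ts v

∷⁺-positive : ∀ {k} ns → 1 ≤ k → k ∷⁺ ns ≡ k ∷ ns
∷⁺-positive {suc k} ns _ = refl

All-∷⁺ : ∀ k ns → All (1 ≤_) ns → All (1 ≤_) (k ∷⁺ ns)
All-∷⁺ zero    ns ps = ps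
All-∷⁺ (suc k) ns ps = s≤s z≤n ∷ ps

runs-positive : ∀ k ts → All (1 ≤_) (runs k ts)
runs-positive k []           = All-∷⁺ k [] []
runs-positive k (false ∷ ts) = runs-positive (suc k) ts
runs-positive k (true ∷ ts)  = All-∷⁺ k _ (runs-positive 0 ts)

Undominated-++-true : ∀ zs ts i → Undominated ts i → Undominated (zs ++ true ∷ ts) (suc (length zs + i))
Undominated-++-true []       ts i u = u
Undominated-++-true (_ ∷ zs) ts i u = Undominated-++-true zs ts i u

Undominated-replicate : ∀ m ts {i} → i < m → Undominated (replicate m false ++ ts) i
Undominated-replicate (suc m) ts {zero}  _         = refl
Undominated-replicate (suc m) ts {suc i} (s≤s i<m) = Undominated-replicate m ts i<m

dominateAt-++-true : ∀ zs ts i → dominateAt (zs ++ true ∷ ts) (suc (length zs + i)) ≡ zs ++ true ∷ dominateAt ts i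
dominateAt-++-true []       ts zero    = refl
dominateAt-++-true []       ts (suc i) = refl
dominateAt-++-true (z ∷ zs) ts i       = cong (z ∷_) (dominateAt-++-true zs ts i)

dominateAt-replicate : ∀ a t u w ts →
  dominateAt (replicate a false ++ t ∷ u ∷ w ∷ ts) (suc a) ≡ replicate a false ++ true ∷ true ∷ true ∷ ts
dominateAt-replicate zero    t u w ts = refl
dominateAt-replicate (suc a) t u w ts = cong (false ∷_) (dominateAt-replicate a t u w ts)

replicate-split : ∀ a b (ts : List Bool) →
  replicate (3 + a + b) false ++ ts ≡ replicate a false ++ false ∷ false ∷ false ∷ replicate b false ++ ts
replicate-split zero    b ts = refl
replicate-split (suc a) b ts = cong (false ∷_) (replicate-split a b ts)

∈-runs⁻ : ∀ k ts m → m ∈ runs k ts →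
  (∃ λ j → ∃ λ ys → ts ≡ replicate j false ++ ys × m ≡ j + k × StartsDominated ys) ⊎
  (∃ λ zs → ∃ λ ys → ts ≡ zs ++ true ∷ replicate m false ++ ys × StartsDominated ys)
∈-runs⁻ k [] m p with ∈-∷⁺⁻ k [] p
... | inj₁ (refl , _) = inj₁ (0 , [] , refl , refl , inj₁ refl)
∈-runs⁻ k (false ∷ ts) m p with ∈-runs⁻ (suc k) ts m p
... | inj₁ (j , ys , refl , refl , sd) = inj₁ (suc j , ys , refl , +-suc j k , sd)
... | inj₂ (zs , ys , refl , sd)       = inj₂ (false ∷ zs , ys , refl , sd)
∈-runs⁻ k (true ∷ ts) m p with ∈-∷⁺⁻ k (runs 0 ts) p
... | inj₁ (refl , _) = inj₁ (0 , true ∷ ts , refl , refl , inj₂ (ts , refl))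
... | inj₂ q with ∈-runs⁻ 0 ts m q
...   | inj₁ (j , ys , refl , refl , sd) =
          inj₂ ([] , ys , cong (λ x → true ∷ replicate x false ++ ys) (sym (+-identityʳ j)) , sd)
...   | inj₂ (zs , ys , refl , sd) = inj₂ (true ∷ zs , ys , refl , sd)

-- Dominator only ever cuts a run at an end by two, or in the middle by three.
data DominatorCut : ℕ → List ℕ → Set where
  trim₂ : ∀ n → DominatorCut (suc n) (pred n ∷⁺ [])
  split : ∀ a b → DominatorCut (3 + a + b) (a ∷⁺ b ∷⁺ [])

DominatorCut-run : ∀ {m ns} ys → DominatorCut m ns → StartsDominated ys →
  ∃ λ i → Undominated (replicate m false ++ ys) i ×
          runs 0 (dominateAt (replicate m false ++ ys) i) ≡ ns ++ runs 0 ys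
DominatorCut-run .[]          (trim₂ zero) (inj₁ refl)        = 0 , refl , refl
DominatorCut-run .(true ∷ ys) (trim₂ zero) (inj₂ (ys , refl)) = 0 , refl , refl
DominatorCut-run ys (trim₂ (suc n)) sd = 0 , refl , trans (runs-block n ys sd) (∷⁺-++ n _)
DominatorCut-run ys (split a b) sd =
  suc a , Undominated-replicate (3 + a + b) ys (s≤s (s≤s (m≤n⇒m≤1+n (m≤m+n a b)))) , (begin
  runs 0 (dominateAt (replicate (3 + a + b) false ++ ys) (suc a))
    ≡⟨ cong (λ ts → runs 0 (dominateAt ts (suc a))) (replicate-split a b ys) ⟩
  runs 0 (dominateAt (replicate a false ++ false ∷ false ∷ false ∷ R) (suc a))
    ≡⟨ cong (runs 0) (dominateAt-replicate a false false false R) ⟩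
  runs 0 (replicate a false ++ true ∷ true ∷ true ∷ R)
    ≡⟨ runs-block a _ (inj₂ (_ , refl)) ⟩
  a ∷⁺ runs 0 R
    ≡⟨ cong (a ∷⁺_) (runs-block b ys sd) ⟩
  a ∷⁺ b ∷⁺ runs 0 ys
    ≡⟨ ∷⁺∷⁺-++ a b _ ⟩
  (a ∷⁺ b ∷⁺ []) ++ runs 0 ys ∎)
  where
  open ≡-Reasoning
  R = replicate b false ++ ys

DominatorCut-realised : ∀ ts {m ns} → m ∈ runs 0 ts → DominatorCut m ns →
  ∃ λ i → Undominated ts i × ∃ λ A → ∃ λ B →
    runs 0 ts ≡ A ++ m ∷ B × runs 0 (dominateAt ts i) ≡ A ++ ns ++ B
DominatorCut-realised ts {m} m∈ cut with ∈-runs⁻ 0 ts m m∈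
... | inj₁ (j , ys , refl , refl , sd) with DominatorCut-run ys cut sd
...   | i , u , eq = i , u′ , [] , runs 0 ys , runs-eq , eq′
  where
  u′ = subst (λ x → Undominated (replicate x false ++ ys) i) (+-identityʳ j) u
  eq′ = subst (λ x → runs 0 (dominateAt (replicate x false ++ ys) i) ≡ _ ++ runs 0 ys) (+-identityʳ j) eq
  runs-eq : runs 0 (replicate j false ++ ys) ≡ (j + 0) ∷ runs 0 ys
  runs-eq = trans (runs-replicate 0 j ys)
              (trans (runs-StartsDominated (j + 0) ys sd) (∷⁺-positive _ (All.lookup (runs-positive 0 ts) m∈)))
DominatorCut-realised ts {m} m∈ cut | inj₂ (zs , ys , refl , sd) with DominatorCut-run ys cut sd
...   | i , u , eq = suc (length zs + i) , Undominated-++-true zs _ i u , runs 0 zs , runs 0 ys ,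
                     runs-eq , trans (cong (runs 0) (dominateAt-++-true zs _ i))
                                     (trans (runs-++-true 0 zs _) (cong (runs 0 zs ++_) eq))
  where
  m≥1 = All.lookup (runs-positive 0 ts) m∈
  runs-eq : runs 0 (zs ++ true ∷ replicate m false ++ ys) ≡ runs 0 zs ++ m ∷ runs 0 ys
  runs-eq = trans (runs-++-true 0 zs _) (cong (runs 0 zs ++_) (trans (runs-block m ys sd) (∷⁺-positive _ m≥1)))

-- Weights

≤-compute : ∀ {m n} {_ : T (m ≤ᵇ n)} → m ≤ n
≤-compute {m} {n} {m≤ᵇn} = ≤ᵇ⇒≤ m n m≤ᵇn

∣-<⇒+≤ : ∀ {d a b} → d ∣ a → d ∣ b → a < b → a + d ≤ b
∣-<⇒+≤ {d} {a} {b} d∣a d∣b a<b = begin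
  a + d       ≤⟨ +-monoʳ-≤ a (∣⇒≤ {{>-nonZero (m<n⇒0<n∸m a<b)}} d∣b∸a) ⟩
  a + (b ∸ a) ≡⟨ m+[n∸m]≡n (<⇒≤ a<b) ⟩
  b           ∎
  where
  open ≤-Reasoning
  d∣b∸a : d ∣ b ∸ a
  d∣b∸a = ∣m+n∣m⇒∣n (subst (d ∣_) (sym (m+[n∸m]≡n (<⇒≤ a<b))) d∣b) d∣a

-- w4 n is four times the weight of P′ n and P″ n.
w4 : ℕ → ℕ
w4 0 = 0
w4 1 = 4
w4 2 = 6
w4 3 = 7
w4 (suc (suc (suc (suc n)))) = 8 + w4 n

w4-divMod : ∀ n → w4 n ≡ 8 * (n / 4) + w4 (n % 4)
w4-divMod n = trans (cong w4 (m≡m%n+[m/n]*n n 4)) (w4-+4* (n / 4) (n % 4) (m%n<n n 4))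
  where
  w4-+4* : ∀ q r → r < 4 → w4 (r + q * 4) ≡ 8 * q + w4 r
  w4-+4* zero    0 _ = refl
  w4-+4* zero    1 _ = refl
  w4-+4* zero    2 _ = refl
  w4-+4* zero    3 _ = refl
  w4-+4* zero    (suc (suc (suc (suc r)))) (s≤s (s≤s (s≤s (s≤s ()))))
  w4-+4* (suc q) r r<4 = begin
    w4 (r + (4 + q * 4)) ≡⟨ cong w4 (x∙yz≈y∙xz r 4 (q * 4)) ⟩
    8 + w4 (r + q * 4)   ≡⟨ cong (8 +_) (w4-+4* q r r<4) ⟩
    8 + (8 * q + w4 r)   ≡⟨ +-assoc 8 (8 * q) (w4 r) ⟨
    8 + 8 * q + w4 r     ≡⟨ cong (_+ w4 r) (*-suc 8 q) ⟨
    8 * suc q + w4 r     ∎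
    where open ≡-Reasoning

W4 : List ℕ → ℕ
W4 []       = 0
W4 (n ∷ ns) = w4 n + W4 ns

W4-++ : ∀ ms ns → W4 (ms ++ ns) ≡ W4 ms + W4 ns
W4-++ []       ns = refl
W4-++ (m ∷ ms) ns = trans (cong (w4 m +_) (W4-++ ms ns)) (sym (+-assoc (w4 m) (W4 ms) (W4 ns)))

W4-∷⁺ : ∀ k ns → W4 (k ∷⁺ ns) ≡ w4 k + W4 ns
W4-∷⁺ zero    ns = refl
W4-∷⁺ (suc k) ns = refl

w4≤W4 : ∀ {m L} → m ∈ L → w4 m ≤ W4 L
w4≤W4 {L = n ∷ L} (here refl) = m≤m+n (w4 n) (W4 L)
w4≤W4 {L = n ∷ L} (there m∈L) = m≤n⇒m≤o+n (w4 n) (w4≤W4 m∈L)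

w4-positive : ∀ n → 1 ≤ n → 4 ≤ w4 n
w4-positive 1 _ = ≤-compute
w4-positive 2 _ = ≤-compute
w4-positive 3 _ = ≤-compute
w4-positive (suc (suc (suc (suc n)))) _ = ≤-trans (≤-compute {4} {8}) (m≤m+n 8 (w4 n))

w4≤w4-suc : ∀ n → w4 n ≤ w4 (suc n)
w4≤w4-suc 0 = ≤-compute
w4≤w4-suc 1 = ≤-compute
w4≤w4-suc 2 = ≤-compute
w4≤w4-suc 3 = ≤-compute
w4≤w4-suc (suc (suc (suc (suc n)))) = +-monoʳ-≤ 8 (w4≤w4-suc n)

-- What Dominator saves by playing the second vertex of a run of length m ≥ 3,
-- or the first one when m ≤ 2 (gain-attained).
gain : ℕ → ℕ
gain 0 = 0
gain 1 = 4
gain 2 = 6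
gain 3 = 7
gain 4 = 4
gain 5 = 6
gain 6 = 7
gain (suc (suc (suc (suc (suc (suc (suc n))))))) = gain (suc (suc (suc n)))

gain≥4 : ∀ m → 1 ≤ m → 4 ≤ gain m
gain≥4 1 _ = ≤-compute
gain≥4 2 _ = ≤-compute
gain≥4 3 _ = ≤-compute
gain≥4 4 _ = ≤-compute
gain≥4 5 _ = ≤-compute
gain≥4 6 _ = ≤-compute
gain≥4 (suc (suc (suc (suc (suc (suc (suc n))))))) _ = gain≥4 (suc (suc (suc n))) (s≤s z≤n)

W4-singleton : ∀ x → W4 (x ∷ []) ≡ w4 x
W4-singleton x = +-identityʳ (w4 x)

W4-insert : ∀ P xs Q → W4 (P ++ xs ++ Q) ≡ W4 (P ++ Q) + W4 xs
W4-insert P xs Q rewrite W4-++ P (xs ++ Q) | W4-++ xs Q | W4-++ P Q = x∙yz≈xz∙y (W4 P) (W4 xs) (W4 Q)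

W4-replace : ∀ A B m ns → W4 (A ++ ns ++ B) + w4 m ≡ W4 (A ++ m ∷ B) + W4 ns
W4-replace A B m ns = begin
  W4 (A ++ ns ++ B) + w4 m      ≡⟨ cong (_+ w4 m) (W4-insert A ns B) ⟩
  W4 (A ++ B) + W4 ns + w4 m    ≡⟨ xy∙z≈xz∙y (W4 (A ++ B)) (W4 ns) (w4 m) ⟩
  W4 (A ++ B) + w4 m + W4 ns    ≡⟨ cong (λ x → W4 (A ++ B) + x + W4 ns) (W4-singleton m) ⟨
  W4 (A ++ B) + W4 (m ∷ []) + W4 ns ≡⟨ cong (_+ W4 ns) (W4-insert A (m ∷ []) B) ⟨
  W4 (A ++ m ∷ B) + W4 ns       ∎
  where open ≡-Reasoning

gain-split₀ : ∀ x → w4 x + gain (3 + x) ≡ w4 (3 + x)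
gain-split₀ 0 = refl
gain-split₀ 1 = refl
gain-split₀ 2 = refl
gain-split₀ 3 = refl
gain-split₀ (suc (suc (suc (suc x)))) = cong (8 +_) (gain-split₀ x)

gain-attained : ∀ m → 1 ≤ m → ∃ λ ns → DominatorCut m ns × W4 ns + gain m ≤ w4 m
gain-attained 1 _ = [] , trim₂ 0 , ≤-refl
gain-attained 2 _ = [] , trim₂ 1 , ≤-refl
gain-attained (suc (suc (suc x))) _ = x ∷⁺ [] , split 0 x ,
  ≤-reflexive (trans (cong (_+ gain (3 + x)) (trans (W4-∷⁺ x []) (+-identityʳ (w4 x)))) (gain-split₀ x))

gain≥6⊎4∣w4 : ∀ x → 1 ≤ x → 6 ≤ gain x ⊎ 4 ∣ w4 x
gain≥6⊎4∣w4 1 _ = inj₂ (divides 1 refl)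
gain≥6⊎4∣w4 2 _ = inj₁ ≤-compute
gain≥6⊎4∣w4 3 _ = inj₁ ≤-compute
gain≥6⊎4∣w4 4 _ = inj₂ (divides 2 refl)
gain≥6⊎4∣w4 5 _ = inj₁ ≤-compute
gain≥6⊎4∣w4 6 _ = inj₁ ≤-compute
gain≥6⊎4∣w4 (suc (suc (suc (suc (suc (suc (suc n))))))) _ with gain≥6⊎4∣w4 (suc (suc (suc n))) (s≤s z≤n)
... | inj₁ big = inj₁ big
... | inj₂ 4∣w = inj₂ (∣m∣n⇒∣m+n (divides 2 refl) 4∣w)

gain≥7⊎2∣w4 : ∀ x → 1 ≤ x → 7 ≤ gain x ⊎ 2 ∣ w4 x
gain≥7⊎2∣w4 1 _ = inj₂ (divides 2 refl)
gain≥7⊎2∣w4 2 _ = inj₂ (divides 3 refl)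
gain≥7⊎2∣w4 3 _ = inj₁ ≤-compute
gain≥7⊎2∣w4 4 _ = inj₂ (divides 4 refl)
gain≥7⊎2∣w4 5 _ = inj₂ (divides 6 refl)
gain≥7⊎2∣w4 6 _ = inj₁ ≤-compute
gain≥7⊎2∣w4 (suc (suc (suc (suc (suc (suc (suc n))))))) _ with gain≥7⊎2∣w4 (suc (suc (suc n))) (s≤s z≤n)
... | inj₁ big = inj₁ big
... | inj₂ 2∣w = inj₂ (∣m∣n⇒∣m+n (divides 4 refl) 2∣w)

someGain≥⊎∣W4 : ∀ {k d} → (∀ x → 1 ≤ x → k ≤ gain x ⊎ d ∣ w4 x) →
  ∀ L → All (1 ≤_) L → (∃ λ m → m ∈ L × k ≤ gain m) ⊎ d ∣ W4 L
someGain≥⊎∣W4 {d = d} pointwise [] [] = inj₂ (divides 0 refl)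
someGain≥⊎∣W4 pointwise (x ∷ L) (x≥1 ∷ L≥1) with pointwise x x≥1 | someGain≥⊎∣W4 pointwise L L≥1
... | inj₁ big | _                      = inj₁ (x , here refl , big)
... | inj₂ _   | inj₁ (m , m∈L , big)   = inj₁ (m , there m∈L , big)
... | inj₂ d∣w | inj₂ d∣W               = inj₂ (∣m∣n⇒∣m+n d∣w d∣W)

trim₁-regained : ∀ n → 3 ≤ n → w4 n + 8 ≤ w4 (suc n) + gain n
trim₁-regained 1 (s≤s ())
trim₁-regained 2 (s≤s (s≤s ()))
trim₁-regained 3 _ = ≤-compute
trim₁-regained 4 _ = ≤-compute
trim₁-regained 5 _ = ≤-compute
trim₁-regained 6 _ = ≤-compute
trim₁-regained (suc (suc (suc (suc (suc (suc (suc k))))))) _ =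
  +-monoʳ-≤ 8 (trim₁-regained (suc (suc (suc k))) (s≤s (s≤s (s≤s z≤n))))

trim₂-regained : ∀ n → 2 ≤ n → w4 n + 8 ≤ w4 (2 + n) + gain n
trim₂-regained 1 (s≤s ())
trim₂-regained 2 _ = ≤-compute
trim₂-regained 3 _ = ≤-compute
trim₂-regained 4 _ = ≤-compute
trim₂-regained 5 _ = ≤-compute
trim₂-regained 6 _ = ≤-compute
trim₂-regained (suc (suc (suc (suc (suc (suc (suc k))))))) _ =
  +-monoʳ-≤ 8 (trim₂-regained (suc (suc (suc k))) (s≤s (s≤s z≤n)))

split-end-regained : ∀ b → w4 b + 8 ≤ w4 (3 + b) + 4
split-end-regained 0 = ≤-compute
split-end-regained 1 = ≤-compute
split-end-regained 2 = ≤-compute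
split-end-regained 3 = ≤-compute
split-end-regained (suc (suc (suc (suc b)))) = +-monoʳ-≤ 8 (split-end-regained b)

gain-suc≤gain-5+ : ∀ a → gain (suc a) ≤ gain (5 + a)
gain-suc≤gain-5+ 0 = ≤-compute
gain-suc≤gain-5+ 1 = ≤-compute
gain-suc≤gain-5+ (suc (suc a)) = ≤-refl

split-regained : ∀ a b → 1 ≤ a → w4 a + w4 b + 8 ≤ w4 (3 + a + b) + gain a
split-regained 1 0 _ = ≤-compute
split-regained 1 1 _ = ≤-compute
split-regained 1 2 _ = ≤-compute
split-regained 1 3 _ = ≤-compute
split-regained 1 (suc (suc (suc (suc b)))) _ = +-monoʳ-≤ 8 (split-regained 1 b (s≤s z≤n))
split-regained 2 0 _ = ≤-compute
split-regained 2 1 _ = ≤-compute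
split-regained 2 2 _ = ≤-compute
split-regained 2 3 _ = ≤-compute
split-regained 2 (suc (suc (suc (suc b)))) _ = +-monoʳ-≤ 8 (split-regained 2 b (s≤s z≤n))
split-regained 3 0 _ = ≤-compute
split-regained 3 1 _ = ≤-compute
split-regained 3 2 _ = ≤-compute
split-regained 3 3 _ = ≤-compute
split-regained 3 (suc (suc (suc (suc b)))) _ = +-monoʳ-≤ 8 (split-regained 3 b (s≤s z≤n))
split-regained 4 0 _ = ≤-compute
split-regained 4 1 _ = ≤-compute
split-regained 4 2 _ = ≤-compute
split-regained 4 3 _ = ≤-compute
split-regained 4 (suc (suc (suc (suc b)))) _ = +-monoʳ-≤ 8 (split-regained 4 b (s≤s z≤n))
split-regained (suc (suc (suc (suc (suc a))))) b _ =
  ≤-trans (+-monoʳ-≤ 8 (split-regained (suc a) b (s≤s z≤n)))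
          (+-monoʳ-≤ (w4 (8 + a + b)) (gain-suc≤gain-5+ a))

-- Dominator's reply

-- A Dominator reply in run m of L after which the weight is at most 4·C − 8.
Response : ℕ → List ℕ → Set
Response C L = ∃ λ m → ∃ λ ns → m ∈ L × DominatorCut m ns × W4 L + 8 + W4 ns ≤ 4 * C + w4 m

respond : ∀ {C L} m → m ∈ L → 1 ≤ m → W4 L + 8 ≤ 4 * C + gain m → Response C L
respond {C} {L} m m∈L m≥1 le with gain-attained m m≥1
... | ns , cut , saved = m , ns , m∈L , cut , (begin
  W4 L + 8 + W4 ns         ≤⟨ +-monoˡ-≤ (W4 ns) le ⟩
  4 * C + gain m + W4 ns   ≡⟨ +-assoc (4 * C) (gain m) (W4 ns) ⟩
  4 * C + (gain m + W4 ns) ≡⟨ cong (4 * C +_) (+-comm (gain m) (W4 ns)) ⟩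
  4 * C + (W4 ns + gain m) ≤⟨ +-monoʳ-≤ (4 * C) saved ⟩
  4 * C + w4 m             ∎)
  where open ≤-Reasoning

-- A Staller move that turned runs of weight X into runs of weight Y, the
-- other runs weighing R, is answered in run m as soon as Y + 8 ≤ X + gain m.
respond-regain : ∀ {C R X} L Y m → m ∈ L → 1 ≤ m → W4 L ≡ R + Y → R + X ≤ 4 * C → Y + 8 ≤ X + gain m →
  Response C L
respond-regain {C} {R} {X} L Y m m∈L m≥1 W4L≡ R+X≤ local = respond {C} m m∈L m≥1 (begin
  W4 L + 8        ≡⟨ cong (_+ 8) W4L≡ ⟩
  R + Y + 8       ≡⟨ +-assoc R Y 8 ⟩
  R + (Y + 8)     ≤⟨ +-monoʳ-≤ R local ⟩
  R + (X + gain m) ≡⟨ +-assoc R X (gain m) ⟨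
  R + X + gain m  ≤⟨ +-monoˡ-≤ (gain m) R+X≤ ⟩
  4 * C + gain m  ∎)
  where open ≤-Reasoning

respond-anywhere : ∀ {C R X} L Y x → x ∈ L → 1 ≤ x → W4 L ≡ R + Y → R + X ≤ 4 * C → Y + 4 ≤ X → Response C L
respond-anywhere {C} {R} {X} L Y x x∈L x≥1 eq R+X≤ Y+4≤X = respond-regain {C} {R} {X} L Y x x∈L x≥1 eq R+X≤
  (subst (_≤ X + gain x) (+-assoc Y 4 4) (+-mono-≤ Y+4≤X (gain≥4 x x≥1)))

∈-∷⁺ : ∀ {k} ns → 1 ≤ k → k ∈ k ∷⁺ ns
∈-∷⁺ {suc k} ns _ = here refl

W4-pair : ∀ m n → W4 (m ∷⁺ n ∷⁺ []) ≡ w4 m + w4 n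
W4-pair m n = trans (W4-∷⁺ m _) (cong (w4 m +_) (trans (W4-∷⁺ n []) (+-identityʳ (w4 n))))

∈-insert⁺ : ∀ {A : Set} P xs {Q} {y : A} → y ∈ P ++ Q → y ∈ P ++ xs ++ Q
∈-insert⁺ P xs y∈ with ∈-++⁻ P y∈
... | inj₁ y∈P = ∈-++⁺ˡ y∈P
... | inj₂ y∈Q = ∈-++⁺ʳ P (∈-++⁺ʳ xs y∈Q)

-- Dominator replies in a run s that his move wipes out entirely (w4 s ≡ gain s).
respond-fresh : ∀ {C R} L s → s ∈ L → 1 ≤ s → W4 L ≡ R + w4 s → w4 s ≡ gain s → R + 8 ≤ 4 * C → Response C L
respond-fresh {C} {R} L s s∈ s≥1 W4L≡ w≡g R+8≤ = respond {C} s s∈ s≥1 (begin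
  W4 L + 8       ≡⟨ cong (_+ 8) W4L≡ ⟩
  R + w4 s + 8   ≡⟨ xy∙z≈xz∙y R (w4 s) 8 ⟩
  R + 8 + w4 s   ≤⟨ +-mono-≤ R+8≤ (≤-reflexive w≡g) ⟩
  4 * C + gain s ∎)
  where open ≤-Reasoning

response-inRun : ∀ C P Q {n ns} → StallerCut n ns → All (1 ≤_) (P ++ n ∷ Q) → All (1 ≤_) (P ++ ns ++ Q) →
  ∃ (_∈ P ++ ns ++ Q) → W4 (P ++ n ∷ Q) ≤ 4 * C → Response C (P ++ ns ++ Q)
response-inRun C P Q {n} {ns} cut L≥1 L′≥1 (x , x∈L′) W4L≤ = answer cut
  where
  L′ = P ++ ns ++ Q
  R = W4 (P ++ Q)
  R+w≤ : R + w4 n ≤ 4 * C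
  R+w≤ = subst (_≤ 4 * C) (trans (W4-insert P (n ∷ []) Q) (cong (R +_) (W4-singleton n))) W4L≤
  W4L′ : W4 L′ ≡ R + W4 ns
  W4L′ = W4-insert P ns Q
  P++Q≥1 : All (1 ≤_) (P ++ Q)
  P++Q≥1 = All.++⁺ (All.++⁻ˡ P L≥1) (All.++⁻ʳ (n ∷ []) (All.++⁻ʳ P L≥1))
  new : ∀ {m} → m ∈ ns → m ∈ L′
  new m∈ = ∈-++⁺ʳ P (∈-++⁺ˡ m∈)
  old : ∀ {m} → m ∈ P ++ Q → m ∈ L′
  old = ∈-insert⁺ P ns
  local : ∀ m → m ∈ L′ → ∀ {Y} → W4 ns ≡ Y → Y + 8 ≤ w4 n + gain m → Response C L′
  local m m∈ refl = respond-regain {C} L′ (W4 ns) m m∈ (All.lookup L′≥1 m∈) W4L′ R+w≤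
  anywhere : W4 ns + 4 ≤ w4 n → Response C L′
  anywhere = respond-anywhere {C} L′ (W4 ns) x x∈L′ (All.lookup L′≥1 x∈L′) W4L′ R+w≤
  -- A remaining deficit of less than d vanishes when d divides everything in sight.
  R+8≤ : ∀ {d} k → d ∣ 4 → d ∣ R → d ∣ k → k + d ≡ 8 → k < w4 n → R + 8 ≤ 4 * C
  R+8≤ {d} k d∣4 d∣R d∣k k+d≡8 k<w = subst (_≤ 4 * C) (trans (+-assoc R k d) (cong (R +_) k+d≡8))
    (∣-<⇒+≤ (∣m∣n⇒∣m+n d∣R d∣k) (∣m⇒∣m*n C d∣4) (<-≤-trans (+-monoʳ-< R k<w) R+w≤))
  fresh : ∀ s → s ∈ ns → W4 ns ≡ w4 s → w4 s ≡ gain s → R + 8 ≤ 4 * C → Response C L′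
  fresh s s∈ W4ns≡ = respond-fresh {C} L′ s (new s∈) (All.lookup L′≥1 (new s∈)) (trans W4L′ (cong (R +_) W4ns≡))
  answer : StallerCut n ns → Response C L′
  answer (trim₁ 0) = anywhere ≤-compute
  answer (trim₁ 1) with someGain≥⊎∣W4 gain≥6⊎4∣w4 (P ++ Q) P++Q≥1
  ... | inj₁ (m , m∈ , big) = local m (old m∈) refl (+-monoʳ-≤ 6 big)
  ... | inj₂ 4∣R = fresh 1 (here refl) refl refl (R+8≤ 4 (divides 1 refl) 4∣R (divides 1 refl) refl ≤-compute)
  answer (trim₁ 2) with someGain≥⊎∣W4 gain≥7⊎2∣w4 (P ++ Q) P++Q≥1
  ... | inj₁ (m , m∈ , big) = local m (old m∈) refl (+-monoʳ-≤ 7 big)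
  ... | inj₂ 2∣R = fresh 2 (here refl) refl refl (R+8≤ 6 (divides 2 refl) 2∣R (divides 3 refl) refl ≤-compute)
  answer (trim₁ (suc (suc (suc k)))) =
    local (3 + k) (new (here refl)) (W4-singleton (3 + k)) (trim₁-regained (3 + k) (s≤s (s≤s (s≤s z≤n))))
  answer (trim₂ 0) = anywhere ≤-compute
  answer (trim₂ 1) = anywhere ≤-compute
  answer (trim₂ 2) with someGain≥⊎∣W4 gain≥6⊎4∣w4 (P ++ Q) P++Q≥1
  ... | inj₁ (m , m∈ , big) = local m (old m∈) refl (+-monoʳ-≤ 7 (≤-trans ≤-compute big))
  ... | inj₂ 4∣R = fresh 1 (here refl) refl refl (R+8≤ 4 (divides 1 refl) 4∣R (divides 1 refl) refl ≤-compute)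
  answer (trim₂ (suc (suc (suc k)))) =
    local (2 + k) (new (here refl)) (W4-singleton (2 + k)) (trim₂-regained (2 + k) (s≤s (s≤s z≤n)))
  answer (split 0 0) = anywhere ≤-compute
  answer (split 0 (suc b)) =
    local (suc b) (new (here refl)) (W4-singleton (suc b))
      (≤-trans (split-end-regained (suc b)) (+-monoʳ-≤ (w4 (4 + b)) (gain≥4 (suc b) (s≤s z≤n))))
  answer (split (suc a) b) =
    local (suc a) (new (here refl)) (W4-pair (suc a) b) (split-regained (suc a) b (s≤s z≤n))

across-regained : ∀ m n → 3 ≤ m → w4 m + w4 n + 8 ≤ w4 (suc m) + w4 (suc n) + gain m
across-regained m n m≥3 = begin
  w4 m + w4 n + 8                  ≡⟨ +-assoc (w4 m) (w4 n) 8 ⟩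
  w4 m + (w4 n + 8)                ≡⟨ cong (w4 m +_) (+-comm (w4 n) 8) ⟩
  w4 m + (8 + w4 n)                ≡⟨ +-assoc (w4 m) 8 (w4 n) ⟨
  w4 m + 8 + w4 n                  ≤⟨ +-mono-≤ (trim₁-regained m m≥3) (w4≤w4-suc n) ⟩
  w4 (suc m) + gain m + w4 (suc n) ≡⟨ +-assoc (w4 (suc m)) (gain m) _ ⟩
  w4 (suc m) + (gain m + w4 (suc n)) ≡⟨ cong (w4 (suc m) +_) (+-comm (gain m) _) ⟩
  w4 (suc m) + (w4 (suc n) + gain m) ≡⟨ +-assoc (w4 (suc m)) _ (gain m) ⟨
  w4 (suc m) + w4 (suc n) + gain m ∎
  where open ≤-Reasoning

response-across : ∀ C P Q m n → All (1 ≤_) (P ++ m ∷⁺ n ∷⁺ Q) → ∃ (_∈ P ++ m ∷⁺ n ∷⁺ Q) →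
  W4 (P ++ suc m ∷ suc n ∷ Q) ≤ 4 * C → Response C (P ++ m ∷⁺ n ∷⁺ Q)
response-across C P Q m n L′≥1 (x , x∈L′) W4L≤ = answer m n refl refl
  where
  L′ = P ++ m ∷⁺ n ∷⁺ Q
  R = W4 (P ++ Q)
  X = w4 (suc m) + w4 (suc n)
  Y = w4 m + w4 n
  R+X≤ : R + X ≤ 4 * C
  R+X≤ = subst (_≤ 4 * C) (trans (W4-insert P (suc m ∷ suc n ∷ []) Q) (cong (R +_) (W4-pair (suc m) (suc n)))) W4L≤
  W4L′ : W4 L′ ≡ R + Y
  W4L′ = trans (cong (λ xs → W4 (P ++ xs)) (∷⁺∷⁺-++ m n Q))
               (trans (W4-insert P (m ∷⁺ n ∷⁺ []) Q) (cong (R +_) (W4-pair m n)))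
  left : 1 ≤ m → Y + 8 ≤ X + gain m → Response C L′
  left m≥1 = respond-regain {C} {R} L′ Y m (∈-++⁺ʳ P (∈-∷⁺ _ m≥1)) m≥1 W4L′ R+X≤
  right : 1 ≤ n → Y + 8 ≤ X + gain n → Response C L′
  right n≥1 = respond-regain {C} {R} L′ Y n (∈-++⁺ʳ P (∈-∷⁺-∷⁺ m n≥1)) n≥1 W4L′ R+X≤
    where
    ∈-∷⁺-∷⁺ : ∀ k → 1 ≤ n → n ∈ k ∷⁺ n ∷⁺ Q
    ∈-∷⁺-∷⁺ zero    n≥1 = ∈-∷⁺ Q n≥1
    ∈-∷⁺-∷⁺ (suc k) n≥1 = there (∈-∷⁺ Q n≥1)
  answer : ∀ m′ n′ → m′ ≡ m → n′ ≡ n → Response C L′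
  answer (suc (suc (suc _))) _ refl refl = left (s≤s z≤n) (across-regained m n (s≤s (s≤s (s≤s z≤n))))
  answer _ (suc (suc (suc _))) refl refl = right (s≤s z≤n)
    (subst₂ _≤_ (cong (_+ 8) (+-comm (w4 n) (w4 m))) (cong (_+ gain n) (+-comm (w4 (suc n)) (w4 (suc m))))
      (across-regained n m (s≤s (s≤s (s≤s z≤n)))))
  answer 0 0 refl refl = respond-anywhere {C} L′ Y x x∈L′ (All.lookup L′≥1 x∈L′) W4L′ R+X≤ ≤-compute
  answer 0 1 refl refl = right (s≤s z≤n) ≤-compute
  answer 0 2 refl refl = right (s≤s z≤n) ≤-compute
  answer 1 0 refl refl = left (s≤s z≤n) ≤-compute
  answer 2 0 refl refl = left (s≤s z≤n) ≤-compute
  answer 1 1 refl refl = left (s≤s z≤n) ≤-compute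
  answer 1 2 refl refl = right (s≤s z≤n) ≤-compute
  answer 2 1 refl refl = left (s≤s z≤n) ≤-compute
  answer 2 2 refl refl = left (s≤s z≤n) ≤-compute

response : ∀ C {L L′} → StallerMove L L′ → All (1 ≤_) L → All (1 ≤_) L′ → ∃ (_∈ L′) → W4 L ≤ 4 * C → Response C L′
response C (inRun P Q n ns cut) L≥1 = response-inRun C P Q cut L≥1
response C (across P Q m n)     _   = response-across C P Q m n

-- Unions of paths as dominance lists

<ᵇ-true : ∀ {m n} → m < n → (m <ᵇ n) ≡ true
<ᵇ-true m<n = Equivalence.to T-≡ (<⇒<ᵇ m<n)

<ᵇ-false : ∀ {m n} → n ≤ m → (m <ᵇ n) ≡ false
<ᵇ-false {m} {n} n≤m with m <ᵇ n in eq
... | false = refl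
... | true  = ⊥-elim (<⇒≱ (<ᵇ⇒< m n (Equivalence.from T-≡ eq)) n≤m)

≡ᵇ-false : ∀ {m n} → m ≢ n → (m ≡ᵇ n) ≡ false
≡ᵇ-false {m} {n} m≢n with m ≡ᵇ n in eq
... | false = refl
... | true  = ⊥-elim (m≢n (≡ᵇ⇒≡ m n (Equivalence.from T-≡ eq)))

≡ᵇ-refl : ∀ m → (m ≡ᵇ m) ≡ true
≡ᵇ-refl m = Equivalence.to T-≡ (≡⇒≡ᵇ m m refl)

≡ᵇ-+ : ∀ s a b → (s + a ≡ᵇ s + b) ≡ (a ≡ᵇ b)
≡ᵇ-+ zero    a b = refl
≡ᵇ-+ (suc s) a b = ≡ᵇ-+ s a b

marks : ℕ → (ℕ → Bool) → List Bool
marks zero    D = []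
marks (suc n) D = D 0 ∷ marks n (λ i → D (suc i))

marks-cong : ∀ n {D D′} → (∀ u → u < n → D u ≡ D′ u) → marks n D ≡ marks n D′
marks-cong zero    eq = refl
marks-cong (suc n) eq = cong₂ _∷_ (eq 0 z<s) (marks-cong n (λ u u<n → eq (suc u) (s<s u<n)))

length-marks : ∀ n D → length (marks n D) ≡ n
length-marks zero    D = refl
length-marks (suc n) D = cong suc (length-marks n _)

Undominated-marks : ∀ n D {u} → u < n → D u ≡ false → Undominated (marks n D) u
Undominated-marks (suc n) D {zero}  _         Du = Du
Undominated-marks (suc n) D {suc u} (s<s u<n) Du = Undominated-marks n _ u<n Du

Undominated-marks⁻ : ∀ n D u → Undominated (marks n D) u → D u ≡ false
Undominated-marks⁻ (suc n) D zero    Du = Du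
Undominated-marks⁻ (suc n) D (suc u) Du = Undominated-marks⁻ n _ u Du

pathN : ℕ → ℕ → Bool
pathN v u = (u ≡ᵇ v) ∨ pathAdj v u

inN-pathG : ∀ F v u → inN (pathG F) v u ≡ pathN v u
inN-pathG (single , n) v u = refl
inN-pathG (double , n) v u = refl

pathN⇒∈N : ∀ v u → pathN v u ≡ true → u ∈N[ v ]
pathN⇒∈N v u h with u ≡ᵇ v in e₁
... | true = inj₁ (≡ᵇ⇒≡ u v (Equivalence.from T-≡ e₁))
... | false with suc v ≡ᵇ u in e₂
...   | true  = inj₂ (inj₁ (sym (≡ᵇ⇒≡ (suc v) u (Equivalence.from T-≡ e₂))))
...   | false = inj₂ (inj₂ (≡ᵇ⇒≡ (suc u) v (Equivalence.from T-≡ h)))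

marks-markHead : ∀ n D → markHead (marks n D) ≡ marks n (λ u → D u ∨ ((0 ≡ᵇ u) ∨ false))
marks-markHead zero    D = refl
marks-markHead (suc n) D =
  cong₂ _∷_ (sym (∨-zeroʳ (D 0))) (marks-cong n (λ u _ → sym (∨-identityʳ (D (suc u)))))

marks-play : ∀ n D v → marks n (λ u → D u ∨ pathN v u) ≡ dominateAt (marks n D) v
marks-play zero    D v                 = refl
marks-play (suc n) D zero              = cong₂ _∷_ (∨-zeroʳ (D 0)) (sym (marks-markHead n _))
marks-play (suc n) D (suc zero)        = cong₂ _∷_ (∨-zeroʳ (D 0)) (marks-play n _ 0)
marks-play (suc n) D (suc (suc v))     = cong₂ _∷_ (∨-identityʳ (D 0)) (marks-play n _ (suc v))

module _ (G H : PDGraph) where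

  inN-⊎G-inside : ∀ {v u} → v < size G → u < size G → inN (G ⊎G H) v u ≡ inN G v u
  inN-⊎G-inside v< u< rewrite <ᵇ-true v< | <ᵇ-true u< = refl

  inN-⊎G-leaving : ∀ {v u} → v < size G → size G ≤ u → inN (G ⊎G H) v u ≡ false
  inN-⊎G-leaving {v} {u} v< u≥
    rewrite <ᵇ-true v< | <ᵇ-false u≥ | ≡ᵇ-false {u} {v} (λ u≡v → <⇒≱ v< (subst (size G ≤_) u≡v u≥)) = refl

  inN-⊎G-entering : ∀ {v u} → size G ≤ v → u < size G → inN (G ⊎G H) v u ≡ false
  inN-⊎G-entering {v} {u} v≥ u<
    rewrite <ᵇ-false v≥ | <ᵇ-true u< | ≡ᵇ-false {u} {v} (λ u≡v → <⇒≱ u< (subst (size G ≤_) (sym u≡v) v≥)) = refl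

  inN-⊎G-shifted : ∀ v u → inN (G ⊎G H) (size G + v) (size G + u) ≡ inN H v u
  inN-⊎G-shifted v u rewrite <ᵇ-false {size G + v} {size G} (m≤m+n (size G) v)
    | <ᵇ-false {size G + u} {size G} (m≤m+n (size G) u)
    | m+n∸m≡n (size G) v | m+n∸m≡n (size G) u | ≡ᵇ-+ (size G) u v = refl

-- The marks of a disjoint union of paths, with a dominated separator after
-- each path; the runs of this list are the runs of the union.
unionMarks : List (Kind × ℕ) → (ℕ → Bool) → List Bool
unionMarks []       D = []
unionMarks (F ∷ Fs) D = marks (size (pathG F)) D ++ true ∷ unionMarks Fs (λ i → D (size (pathG F) + i))

unionMarks-cong : ∀ Fs {D D′} → (∀ u → D u ≡ D′ u) → unionMarks Fs D ≡ unionMarks Fs D′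
unionMarks-cong []       eq = refl
unionMarks-cong (F ∷ Fs) eq =
  cong₂ (λ xs ys → xs ++ true ∷ ys) (marks-cong (size (pathG F)) (λ u _ → eq u))
                                    (unionMarks-cong Fs (λ u → eq (size (pathG F) + u)))

dominateAt-++-true-left : ∀ xs ys v → v < length xs → dominateAt (xs ++ true ∷ ys) v ≡ dominateAt xs v ++ true ∷ ys
dominateAt-++-true-left (x ∷ [])     ys zero          _         = refl
dominateAt-++-true-left (x ∷ y ∷ xs) ys zero          _         = refl
dominateAt-++-true-left (x ∷ xs)     ys (suc zero)    (s<s v<)  = cong (true ∷_) (dominateAt-++-true-left xs ys 0 v<)
dominateAt-++-true-left (x ∷ xs)     ys (suc (suc v)) (s<s v<)  = cong (x ∷_) (dominateAt-++-true-left xs ys (suc v) v<)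

Undominated-++ˡ : ∀ xs ys i → Undominated xs i → Undominated (xs ++ ys) i
Undominated-++ˡ (x ∷ xs) ys zero    u = u
Undominated-++ˡ (x ∷ xs) ys (suc i) u = Undominated-++ˡ xs ys i u

Undominated-++-true⁻ : ∀ xs ys i → Undominated (xs ++ true ∷ ys) i →
  (i < length xs × Undominated xs i) ⊎ ∃ λ j → i ≡ suc (length xs + j) × Undominated ys j
Undominated-++-true⁻ []       ys (suc i) u = inj₂ (i , refl , u)
Undominated-++-true⁻ (x ∷ xs) ys zero    u = inj₁ (z<s , u)
Undominated-++-true⁻ (x ∷ xs) ys (suc i) u with Undominated-++-true⁻ xs ys i u
... | inj₁ (i< , u′)      = inj₁ (s<s i< , u′)
... | inj₂ (j , refl , u′) = inj₂ (j , refl , u′)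

LegalAt-++-true : ∀ xs ys i → LegalAt ys i → LegalAt (xs ++ true ∷ ys) (suc (length xs + i))
LegalAt-++-true xs ys i (j , j∈N , u) = suc (length xs + j) , shift j∈N , Undominated-++-true xs ys j u
  where
  shift : j ∈N[ i ] → suc (length xs + j) ∈N[ suc (length xs + i) ]
  shift (inj₁ refl)        = inj₁ refl
  shift (inj₂ (inj₁ refl)) = inj₂ (inj₁ (cong suc (+-suc (length xs) i)))
  shift (inj₂ (inj₂ refl)) = inj₂ (inj₂ (cong suc (sym (+-suc (length xs) j))))

Simulates : List (Kind × ℕ) → (ℕ → Bool) → ℕ → ℕ → Set
Simulates Fs D v i = unionMarks Fs (play (unionG Fs) D v) ≡ dominateAt (unionMarks Fs D) i

Simulates-first : ∀ F Fs D v → v < size (pathG F) → Simulates (F ∷ Fs) D v v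
Simulates-first F Fs D v v<s = begin
  marks s (λ u → D u ∨ inN GH v u) ++ true ∷ unionMarks Fs (λ i → D (s + i) ∨ inN GH v (s + i))
    ≡⟨ cong₂ (λ xs ys → xs ++ true ∷ ys)
         (marks-cong s (λ u u<s → cong (D u ∨_) (trans (inN-⊎G-inside G H v<s u<s) (inN-pathG F v u))))
         (unionMarks-cong Fs (λ i → trans (cong (D (s + i) ∨_) (inN-⊎G-leaving G H v<s (m≤m+n s i))) (∨-identityʳ _))) ⟩
  marks s (λ u → D u ∨ pathN v u) ++ true ∷ unionMarks Fs (λ i → D (s + i))
    ≡⟨ cong (_++ true ∷ unionMarks Fs (λ i → D (s + i))) (marks-play s D v) ⟩
  dominateAt (marks s D) v ++ true ∷ unionMarks Fs (λ i → D (s + i))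
    ≡⟨ dominateAt-++-true-left (marks s D) _ v (subst (v <_) (sym (length-marks s D)) v<s) ⟨
  dominateAt (marks s D ++ true ∷ unionMarks Fs (λ i → D (s + i))) v ∎
  where
  open ≡-Reasoning
  G = pathG F
  H = unionG Fs
  s = size G
  GH = unionG (F ∷ Fs)

Simulates-rest : ∀ F Fs D v i → Simulates Fs (λ j → D (size (pathG F) + j)) v i →
  Simulates (F ∷ Fs) D (size (pathG F) + v) (suc (length (marks (size (pathG F)) D) + i))
Simulates-rest F Fs D v i sim = begin
  marks s (λ u → D u ∨ inN GH (s + v) u) ++ true ∷ unionMarks Fs (λ j → D (s + j) ∨ inN GH (s + v) (s + j))
    ≡⟨ cong₂ (λ xs ys → xs ++ true ∷ ys)
         (marks-cong s (λ u u<s → trans (cong (D u ∨_) (inN-⊎G-entering G H (m≤m+n s v) u<s)) (∨-identityʳ _)))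
         (unionMarks-cong Fs (λ j → cong (D (s + j) ∨_) (inN-⊎G-shifted G H v j))) ⟩
  marks s D ++ true ∷ unionMarks Fs (play H (λ j → D (s + j)) v)
    ≡⟨ cong (λ ys → marks s D ++ true ∷ ys) sim ⟩
  marks s D ++ true ∷ dominateAt (unionMarks Fs (λ j → D (s + j))) i
    ≡⟨ dominateAt-++-true (marks s D) _ i ⟨
  dominateAt (marks s D ++ true ∷ unionMarks Fs (λ j → D (s + j))) (suc (length (marks s D) + i)) ∎
  where
  open ≡-Reasoning
  G = pathG F
  H = unionG Fs
  s = size G
  GH = unionG (F ∷ Fs)

legal⇒LegalAt : ∀ Fs D v u → v < size (unionG Fs) → inN (unionG Fs) v u ≡ true → D u ≡ false →
  ∃ λ i → LegalAt (unionMarks Fs D) i × Simulates Fs D v i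
legal⇒LegalAt (F ∷ Fs) D v u v< u∈N[v] Du with v <? size (pathG F) | u <? size (pathG F)
... | yes v<s | yes u<s =
  v , (u , pathN⇒∈N v u (trans (sym (trans (inN-⊎G-inside (pathG F) (unionG Fs) v<s u<s) (inN-pathG F v u))) u∈N[v]) ,
       Undominated-++ˡ (marks (size (pathG F)) D) _ u (Undominated-marks (size (pathG F)) D u<s Du)) ,
  Simulates-first F Fs D v v<s
... | yes v<s | no u≮s = contradiction (trans (sym u∈N[v]) (inN-⊎G-leaving (pathG F) (unionG Fs) v<s (≮⇒≥ u≮s))) λ ()
... | no v≮s | yes u<s = contradiction (trans (sym u∈N[v]) (inN-⊎G-entering (pathG F) (unionG Fs) (≮⇒≥ v≮s) u<s)) λ ()
... | no v≮s | no u≮s = subst (λ v → ∃ λ i → LegalAt (unionMarks (F ∷ Fs) D) i × Simulates (F ∷ Fs) D v i) s+v′≡v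
  (suc (length (marks s D) + i) , LegalAt-++-true (marks s D) _ i legalᵢ , Simulates-rest F Fs D v′ i sim)
  where
  s = size (pathG F)
  v′ = v ∸ s
  u′ = u ∸ s
  s+v′≡v : s + v′ ≡ v
  s+v′≡v = m+[n∸m]≡n (≮⇒≥ v≮s)
  s+u′≡u : s + u′ ≡ u
  s+u′≡u = m+[n∸m]≡n (≮⇒≥ u≮s)
  rest = legal⇒LegalAt Fs (λ j → D (s + j)) v′ u′
    (+-cancelˡ-< s v′ _ (subst (_< s + size (unionG Fs)) (sym s+v′≡v) v<))
    (trans (sym (inN-⊎G-shifted (pathG F) (unionG Fs) v′ u′))
           (subst₂ (λ a b → inN (unionG (F ∷ Fs)) a b ≡ true) (sym s+v′≡v) (sym s+u′≡u) u∈N[v]))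
    (subst (λ a → D a ≡ false) (sym s+u′≡u) Du)
  i = proj₁ rest
  legalᵢ = proj₁ (proj₂ rest)
  sim = proj₂ (proj₂ rest)

Undominated⇒vertex : ∀ Fs D i → Undominated (unionMarks Fs D) i →
  ∃ λ v → v < size (unionG Fs) × D v ≡ false × Simulates Fs D v i
Undominated⇒vertex (F ∷ Fs) D i u with Undominated-++-true⁻ (marks (size (pathG F)) D) _ i u
... | inj₁ (i<len , u₁) =
  i , ≤-trans i<s (m≤m+n (size (pathG F)) _) , Undominated-marks⁻ (size (pathG F)) D i u₁ , Simulates-first F Fs D i i<s
  where i<s = subst (i <_) (length-marks (size (pathG F)) D) i<len
... | inj₂ (j , refl , u₂) with Undominated⇒vertex Fs (λ k → D (size (pathG F) + k)) j u₂
...   | v , v< , Dv , sim =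
  size (pathG F) + v , +-monoʳ-< (size (pathG F)) v< , Dv , Simulates-rest F Fs D v j sim

-- Bounding the length of the game

foldr-⊔-lub : ∀ {B} x xs → x ≤ B → All (_≤ B) xs → foldr _⊔_ x xs ≤ B
foldr-⊔-lub x []       x≤B []           = x≤B
foldr-⊔-lub x (y ∷ xs) x≤B (y≤B ∷ xs≤B) = ⊔-lub y≤B (foldr-⊔-lub x xs x≤B xs≤B)

foldr-⊓≤ : ∀ {y} x xs → y ∈ x ∷ xs → foldr _⊓_ x xs ≤ y
foldr-⊓≤ x []       (here refl)         = ≤-refl
foldr-⊓≤ x (z ∷ zs) (here refl)         = ≤-trans (m⊓n≤n z _) (foldr-⊓≤ x zs (here refl))
foldr-⊓≤ x (z ∷ zs) (there (here refl)) = m⊓n≤m z _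
foldr-⊓≤ x (z ∷ zs) (there (there y∈))  = ≤-trans (m⊓n≤n z _) (foldr-⊓≤ x zs (there y∈))

≤4*-suc : ∀ {a} C → 4 ≤ a → a ≤ 4 * C → ∃ λ C′ → C ≡ suc C′
≤4*-suc zero    4≤a a≤0 = contradiction (≤-trans 4≤a a≤0) λ ()
≤4*-suc (suc C) _   _   = C , refl

+8≤4*-suc-suc : ∀ {a} C → a + 8 ≤ 4 * C → ∃ λ C′ → C ≡ suc (suc C′) × a ≤ 4 * C′
+8≤4*-suc-suc zero          le = contradiction (≤-trans (m≤n+m 8 _) le) λ ()
+8≤4*-suc-suc (suc zero)    le = contradiction (≤-trans (m≤n+m 8 _) le) (<⇒≱ (≤-compute {5} {8}))
+8≤4*-suc-suc {a} (suc (suc C)) le =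
  C , refl , +-cancelˡ-≤ 8 a (4 * C) (subst₂ _≤_ (+-comm a 8) (*-distribˡ-+ 4 2 C) le)

-- The legal moves exactly as value lists them, so that with moves G D abstracts them there.
moves : PDGraph → (ℕ → Bool) → List ℕ
moves G D = filter (λ v → legal G D v ≟ true) (upTo (size G))

module _ (Fs : List (Kind × ℕ)) where

  private
    G = unionG Fs

  runsOf : (ℕ → Bool) → List ℕ
  runsOf D = runs 0 (unionMarks Fs D)

  ∈-moves⁻ : ∀ {D v} → v ∈ moves G D → ∃ λ u → v < size G × inN G v u ≡ true × D u ≡ false
  ∈-moves⁻ {D} {v} v∈ with ∈-filter⁻ (λ v → legal G D v ≟ true) v∈
  ... | v∈upTo , legal-v with find (any⁻ _ (upTo (size G)) (Equivalence.from T-≡ legal-v))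
  ...   | u , _ , u-new with Equivalence.to T-∧ u-new
  ...     | u∈N , Du = u , ∈-upTo⁻ v∈upTo , Equivalence.to T-≡ u∈N , Equivalence.to T-not-≡ Du

  undominated∈moves : ∀ {D v} → v < size G → D v ≡ false → v ∈ moves G D
  undominated∈moves {D} {v} v< Dv = ∈-filter⁺ (λ v → legal G D v ≟ true) (∈-upTo⁺ v<)
    (Equivalence.to T-≡ (any⁺ _ (lose (∈-upTo⁺ v<) v-new)))
    where
    v-new : T (inN G v v ∧ not (D v))
    v-new rewrite ≡ᵇ-refl v | Dv = _

  move⇒StallerMove : ∀ {D v} → v ∈ moves G D → StallerMove (runsOf D) (runsOf (play G D v))
  move⇒StallerMove {D} {v} v∈ with ∈-moves⁻ v∈
  ... | u , v< , u∈N , Du with legal⇒LegalAt Fs D v u v< u∈N Du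
  ...   | i , legalᵢ , sim = subst (λ ts → StallerMove (runsOf D) (runs 0 ts)) (sym sim) (LegalAt⇒StallerMove (unionMarks Fs D) i legalᵢ)

  4≤W4-runsOf : ∀ {D D′} → StallerMove (runsOf D) D′ → 4 ≤ W4 (runsOf D)
  4≤W4-runsOf {D} sm with StallerMove-source sm
  ... | m , m∈ = ≤-trans (w4-positive m (All.lookup (runs-positive 0 (unionMarks Fs D)) m∈)) (w4≤W4 m∈)

  dominator-reply : ∀ {D D′ z} C → StallerMove (runsOf D) (runsOf D′) → W4 (runsOf D) ≤ 4 * C → z ∈ moves G D′ →
    ∃ λ v → v ∈ moves G D′ × W4 (runsOf (play G D′ v)) + 8 ≤ 4 * C
  dominator-reply {D} {D′} C sm bound z∈
    with response C sm (runs-positive 0 (unionMarks Fs D)) (runs-positive 0 (unionMarks Fs D′)) (StallerMove-source (move⇒StallerMove z∈)) bound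
  ... | m , ns , m∈ , cut , regained with DominatorCut-realised (unionMarks Fs D′) m∈ cut
  ...   | i , undominated , A , B , runs≡ , cut≡ with Undominated⇒vertex Fs D′ i undominated
  ...     | v , v< , Dv , sim = v , undominated∈moves v< Dv , +-cancelʳ-≤ (w4 m) _ _ (begin
    W4 L″ + 8 + w4 m            ≡⟨ xy∙z≈xz∙y (W4 L″) 8 (w4 m) ⟩
    W4 L″ + w4 m + 8            ≡⟨ cong (_+ 8) W4L″ ⟩
    W4 (runsOf D′) + W4 ns + 8  ≡⟨ xy∙z≈xz∙y (W4 (runsOf D′)) (W4 ns) 8 ⟩
    W4 (runsOf D′) + 8 + W4 ns  ≤⟨ regained ⟩
    4 * C + w4 m                ∎)
    where
    open ≤-Reasoning
    L″ = runsOf (play G D′ v)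
    W4L″ : W4 L″ + w4 m ≡ W4 (runsOf D′) + W4 ns
    W4L″ = begin-equality
      W4 L″ + w4 m ≡⟨ cong (λ ts → W4 (runs 0 ts) + w4 m) sim ⟩
      W4 (runs 0 (dominateAt (unionMarks Fs D′) i)) + w4 m ≡⟨ cong (λ L → W4 L + w4 m) cut≡ ⟩
      W4 (A ++ ns ++ B) + w4 m ≡⟨ W4-replace A B m ns ⟩
      W4 (A ++ m ∷ B) + W4 ns ≡⟨ cong (λ L → W4 L + W4 ns) runs≡ ⟨
      W4 (runsOf D′) + W4 ns ∎

  staller-bound : ∀ f D C → W4 (runsOf D) ≤ 4 * C → value G f true D ≤ C
  dominator-bound : ∀ f {D} D′ C → StallerMove (runsOf D) (runsOf D′) → W4 (runsOf D) ≤ 4 * suc C →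
    value G f false D′ ≤ C

  staller-bound zero    D C _ = z≤n
  staller-bound (suc f) D C bound with moves G D in eq
  ... | [] = z≤n
  ... | x ∷ xs with ≤4*-suc C (4≤W4-runsOf (move⇒StallerMove {D} {x} (subst (x ∈_) (sym eq) (here refl)))) bound
  ...   | C′ , refl = s≤s (foldr-⊔-lub (next x) (map next xs) (next≤ (here refl)) (All.map⁺ (tabulate (next≤ ∘ there))))
    where
    ∈-moves : ∀ {y} → y ∈ x ∷ xs → y ∈ moves G D
    ∈-moves {y} y∈ = subst (y ∈_) (sym eq) y∈
    next : ℕ → ℕ
    next v = value G f false (play G D v)
    next≤ : ∀ {y} → y ∈ x ∷ xs → next y ≤ C′
    next≤ {y} y∈ = dominator-bound f {D} (play G D y) C′ (move⇒StallerMove (∈-moves y∈)) bound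

  dominator-bound zero    D′ C _ _ = z≤n
  dominator-bound (suc f) {D} D′ C sm bound with moves G D′ in eq
  ... | [] = z≤n
  ... | z ∷ zs = reply (dominator-reply {D} {D′} {z} (suc C) sm bound (subst (z ∈_) (sym eq) (here refl)))
    where
    next : ℕ → ℕ
    next y = value G f true (play G D′ y)
    reply : (∃ λ v → v ∈ moves G D′ × W4 (runsOf (play G D′ v)) + 8 ≤ 4 * suc C) → suc (foldr _⊓_ (next z) (map next zs)) ≤ C
    reply (v , v∈ , regained) with +8≤4*-suc-suc (suc C) regained
    ... | C″ , refl , bound′ = s≤s (≤-trans (foldr-⊓≤ (next z) (map next zs) (∈-map⁺ next (subst (v ∈_) eq v∈)))
                                            (staller-bound f (play G D′ v) C″ bound′))

-- The total weight as a rational number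

-- Opened only here: its prefix +_ would make the sections (x +_) above ambiguous.
open import Data.Integer using (+_; -[1+_]; +0; +[1+_]; +≤+) renaming (_≤_ to _≤ℤ_)

w4Sum : List (Kind × ℕ) → ℕ
w4Sum []       = 0
w4Sum (F ∷ Fs) = w4 (proj₂ F) + w4Sum Fs

-- mkℚᵘ n 3 is n / 4: an unnormalised rational stores its denominator minus one.
cr≃w4/4 : ∀ r → r < 4 → toℚᵘ (cr r) ≃ mkℚᵘ (+ w4 r) 3
cr≃w4/4 0 _ = *≡* refl
cr≃w4/4 1 _ = *≡* refl
cr≃w4/4 2 _ = *≡* refl
cr≃w4/4 3 _ = *≡* refl
cr≃w4/4 (suc (suc (suc (suc r)))) (s≤s (s≤s (s≤s (s≤s ()))))

integer+quarters : ∀ q c → mkℚᵘ (+ (2 * q)) 0 ℚᵘ.+ mkℚᵘ (+ c) 3 ≃ mkℚᵘ (+ (8 * q + c)) 3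
integer+quarters q c = *≡* (begin
  (+ (2 * q) ℤ.* + 4 ℤ.+ + c ℤ.* + 1) ℤ.* + 4   ≡⟨ cong (λ z → (z ℤ.* + 4 ℤ.+ + c ℤ.* + 1) ℤ.* + 4) (ℤ.pos-* 2 q) ⟩
  (+ 2 ℤ.* + q ℤ.* + 4 ℤ.+ + c ℤ.* + 1) ℤ.* + 4 ≡⟨ identity (+ q) (+ c) ⟩
  (+ 8 ℤ.* + q ℤ.+ + c) ℤ.* + 4                 ≡⟨ cong (ℤ._* + 4) (trans (ℤ.pos-+ (8 * q) c) (cong (ℤ._+ + c) (ℤ.pos-* 8 q))) ⟨
  + (8 * q + c) ℤ.* + 4                         ∎)
  where
  open ≡-Reasoning
  identity : ∀ q c → (+ 2 ℤ.* q ℤ.* + 4 ℤ.+ c ℤ.* + 1) ℤ.* + 4 ≡ (+ 8 ℤ.* q ℤ.+ c) ℤ.* + 4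
  identity = solve-∀

quarters+quarters : ∀ a b → mkℚᵘ (+ a) 3 ℚᵘ.+ mkℚᵘ (+ b) 3 ≃ mkℚᵘ (+ (a + b)) 3
quarters+quarters a b = *≡* (trans (identity (+ a) (+ b)) (cong (ℤ._* + 16) (sym (ℤ.pos-+ a b))))
  where
  identity : ∀ a b → (a ℤ.* + 4 ℤ.+ b ℤ.* + 4) ℤ.* + 4 ≡ (a ℤ.+ b) ℤ.* + 16
  identity = solve-∀

weight≃w4/4 : ∀ F → toℚᵘ (weight F) ≃ mkℚᵘ (+ w4 (proj₂ F)) 3
weight≃w4/4 (k , n) = begin
  toℚᵘ (weight (k , n))                   ≈⟨ ℚ.toℚᵘ-homo-+ (+ (2 * q) ℚ./ 1) (cr r) ⟩
  toℚᵘ (+ (2 * q) ℚ./ 1) ℚᵘ.+ toℚᵘ (cr r) ≈⟨ ℚᵘ.+-cong (ℚ.toℚᵘ-fromℚᵘ (mkℚᵘ (+ (2 * q)) 0)) (cr≃w4/4 r (m%n<n n 4)) ⟩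
  mkℚᵘ (+ (2 * q)) 0 ℚᵘ.+ mkℚᵘ (+ w4 r) 3 ≈⟨ integer+quarters q (w4 r) ⟩
  mkℚᵘ (+ (8 * q + w4 r)) 3               ≡⟨ cong (λ x → mkℚᵘ (+ x) 3) (w4-divMod n) ⟨
  mkℚᵘ (+ w4 n) 3                         ∎
  where
  open ℚᵘ.≃-Reasoning
  q = n / 4
  r = n % 4

totalWeight≃w4Sum/4 : ∀ Fs → toℚᵘ (totalWeight Fs) ≃ mkℚᵘ (+ w4Sum Fs) 3
totalWeight≃w4Sum/4 []       = *≡* refl
totalWeight≃w4Sum/4 (F ∷ Fs) = ℚᵘ.≃-trans (ℚ.toℚᵘ-homo-+ (weight F) (totalWeight Fs))
  (ℚᵘ.≃-trans (ℚᵘ.+-cong (weight≃w4/4 F) (totalWeight≃w4Sum/4 Fs)) (quarters+quarters (w4 (proj₂ F)) (w4Sum Fs)))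

floor*↧≤↥ : ∀ p → floor p ℤ.* ↧ p ℤ.≤ ↥ p
floor*↧≤↥ p@record{} = [n/d]*d≤n (↥ p) (↧ p)

↥≤ceiling*↧ : ∀ p → ↥ p ℤ.≤ ceiling p ℤ.* ↧ p
↥≤ceiling*↧ p@(mkℚ n _ _) = begin
  n                  ≡⟨ ℤ.neg-involutive n ⟨
  ℤ.- (ℤ.- n)        ≤⟨ ℤ.neg-mono-≤ floor*↧≤ ⟩
  ℤ.- (f ℤ.* ↧ p)    ≡⟨ ℤ.neg-distribˡ-* f (↧ p) ⟩
  ceiling p ℤ.* ↧ p  ∎
  where
  open ℤ.≤-Reasoning
  f = floor (ℚ.- p)
  floor*↧≤ : f ℤ.* ↧ p ℤ.≤ ℤ.- n
  floor*↧≤ = subst₂ (λ d m → f ℤ.* d ℤ.≤ m) (↧-neg p) (ℚ.↥-neg p) (floor*↧≤↥ (ℚ.- p))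
    where
    ↧-neg : ∀ p → ↧ (ℚ.- p) ≡ ↧ p
    ↧-neg (mkℚ -[1+ _ ] _ _) = refl
    ↧-neg (mkℚ +0       _ _) = refl
    ↧-neg (mkℚ +[1+ _ ] _ _) = refl

≃quarters⇒≤4*ceiling : ∀ p X → toℚᵘ p ≃ mkℚᵘ (+ X) 3 → ∃ λ C → ceiling p ≡ + C × X ≤ 4 * C
≃quarters⇒≤4*ceiling p@(mkℚ _ _ _) X (*≡* eq) = toℕ (ceiling p) X≤c*4
  where
  X≤c*4 : + X ℤ.≤ ceiling p ℤ.* + 4
  X≤c*4 = ℤ.*-cancelʳ-≤-pos (+ X) (ceiling p ℤ.* + 4) (↧ p) (begin
    + X ℤ.* ↧ p                   ≡⟨ eq ⟨
    ↥ p ℤ.* + 4                   ≤⟨ ℤ.*-monoʳ-≤-nonNeg (+ 4) (↥≤ceiling*↧ p) ⟩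
    ceiling p ℤ.* ↧ p ℤ.* + 4     ≡⟨ ℤ.*-assoc (ceiling p) (↧ p) (+ 4) ⟩
    ceiling p ℤ.* (↧ p ℤ.* + 4)   ≡⟨ cong (ceiling p ℤ.*_) (ℤ.*-comm (↧ p) (+ 4)) ⟩
    ceiling p ℤ.* (+ 4 ℤ.* ↧ p)   ≡⟨ ℤ.*-assoc (ceiling p) (+ 4) (↧ p) ⟨
    ceiling p ℤ.* + 4 ℤ.* ↧ p     ∎)
    where open ℤ.≤-Reasoning
  toℕ : ∀ c → + X ℤ.≤ c ℤ.* + 4 → ∃ λ C → c ≡ + C × X ≤ 4 * C
  toℕ (+ C) le = C , refl , subst (X ≤_) (*-comm C 4) (ℤ.drop‿+≤+ (subst (+ X ℤ.≤_) (sym (ℤ.pos-* C 4)) le))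
  toℕ -[1+ _ ] ()

-- The initial position

marks-false : ∀ n → marks n (λ _ → false) ≡ replicate n false
marks-false zero    = refl
marks-false (suc n) = cong (false ∷_) (marks-false n)

marks-last : ∀ n → marks (suc n) (λ i → i ≡ᵇ n) ≡ replicate n false ++ true ∷ []
marks-last zero    = refl
marks-last (suc n) = cong (false ∷_) (marks-last n)

W4-runs-replicate : ∀ n ts → StartsDominated ts → W4 (runs 0 (replicate n false ++ ts)) ≡ w4 n + W4 (runs 0 ts)
W4-runs-replicate n ts sd = trans (cong W4 (runs-block n ts sd)) (W4-∷⁺ n _)

W4-runs-path : ∀ F → W4 (runs 0 (marks (size (pathG F)) (predom (pathG F)))) ≡ w4 (proj₂ F)
W4-runs-path (single , n) = begin
  W4 (runs 0 (marks n (λ _ → false)))   ≡⟨ cong (λ ts → W4 (runs 0 ts)) (trans (marks-false n) (sym (++-identityʳ _))) ⟩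
  W4 (runs 0 (replicate n false ++ [])) ≡⟨ W4-runs-replicate n [] (inj₁ refl) ⟩
  w4 n + 0                              ≡⟨ +-identityʳ (w4 n) ⟩
  w4 n                                  ∎
  where open ≡-Reasoning
W4-runs-path (double , n) = begin
  W4 (runs 0 (marks (suc n) (λ i → i ≡ᵇ n)))   ≡⟨ cong (λ ts → W4 (runs 0 ts)) (marks-last n) ⟩
  W4 (runs 0 (replicate n false ++ true ∷ [])) ≡⟨ W4-runs-replicate n (true ∷ []) (inj₂ ([] , refl)) ⟩
  w4 n + 0                                     ≡⟨ +-identityʳ (w4 n) ⟩
  w4 n                                         ∎
  where open ≡-Reasoning

W4-runs-initial : ∀ Fs → W4 (runsOf Fs (predom (unionG Fs))) ≡ w4Sum Fs
W4-runs-initial []       = refl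
W4-runs-initial (F ∷ Fs) = begin
  W4 (runs 0 (marks s (predom U) ++ true ∷ unionMarks Fs (λ i → predom U (s + i))))
    ≡⟨ cong₂ (λ xs ys → W4 (runs 0 (xs ++ true ∷ ys))) (marks-cong s inside) (unionMarks-cong Fs shifted) ⟩
  W4 (runs 0 (marks s (predom (pathG F)) ++ true ∷ unionMarks Fs (predom (unionG Fs))))
    ≡⟨ cong W4 (runs-++-true 0 (marks s (predom (pathG F))) _) ⟩
  W4 (runs 0 (marks s (predom (pathG F))) ++ runsOf Fs (predom (unionG Fs)))
    ≡⟨ W4-++ (runs 0 (marks s (predom (pathG F)))) _ ⟩
  W4 (runs 0 (marks s (predom (pathG F)))) + W4 (runsOf Fs (predom (unionG Fs)))
    ≡⟨ cong₂ _+_ (W4-runs-path F) (W4-runs-initial Fs) ⟩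
  w4 (proj₂ F) + w4Sum Fs ∎
  where
  open ≡-Reasoning
  s = size (pathG F)
  U = unionG (F ∷ Fs)
  inside : ∀ u → u < s → predom U u ≡ predom (pathG F) u
  inside u u<s rewrite <ᵇ-true u<s = refl
  shifted : ∀ i → predom U (s + i) ≡ predom (unionG Fs) i
  shifted i rewrite <ᵇ-false {s + i} {s} (m≤m+n s i) | m+n∸m≡n s i = refl

lemma3p2 : (Fs : List (Kind × ℕ)) → All (λ F → proj₂ F ≥ 1) Fs →
    + gammaG' (unionG Fs) ≤ℤ ceiling (totalWeight Fs)
lemma3p2 Fs _ with ≃quarters⇒≤4*ceiling (totalWeight Fs) (w4Sum Fs) (totalWeight≃w4Sum/4 Fs)
... | C , ceiling≡ , w4Sum≤ rewrite ceiling≡ = +≤+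
  (staller-bound Fs (size (unionG Fs)) (predom (unionG Fs)) C (subst (_≤ 4 * C) (sym (W4-runs-initial Fs)) w4Sum≤))
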